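{- Let $\mathbb{D}$ be a bilinear dimensional dual hyperoval (DHO) of rank $n$ over $\mathbb{F}_2$. Then its opposite $\mathbb{D}^\circ$ is a bilinear DHO as well.
   Context: A dimensional dual hyperoval of rank $n\ge 2$ in an $(n+r)$-dimensional $\mathbb{F}_q$-space $U$ is a collection $\mathbb{D}$ of $n$-dimensional subspaces such that any two distinct members meet in a $1$-dimensional subspace, any three distinct members meet only in $\{\mathbf 0\}$, and $\#\mathbb{D}=q^{n-1}+\dots+q+2$. Here $q=2$ and $\mathbb{D}$ splits over an $r$-dimensional subspace $Y$ (i.e. $U=X\oplus Y$ for all $X\in\mathbb{D}$), so that, identifying $U$ with $X\times Y$ for a fixed member $X$, there is an injective map $\beta$ from $X$ into $\mathrm{Hom}(X,Y)$ with $\mathbb{D}=\{X(\mathbf a):\mathbf a\in X\}$, where $X(\mathbf a)=\{(\mathbf x,\mathbf x\beta(\mathbf a)):\mathbf x\in X\}$. The set $\mathcal D=\{\beta(\mathbf a):\mathbf a\in X\}$ (the DHO-set) satisfies: (P1) $\beta(\mathbf a)-\beta(\mathbf b)$ has rank $n-1$ for distinct $\mathbf a,\mathbf b\in X$; (P2) for each $\mathbf a\in X$, the map sending $\mathbf b\in X\setminus\{\mathbf a\}$ to the kernel of $\beta(\mathbf a)-\beta(\mathbf b)$ is a bijection onto the set of $1$-dimensional subspaces of $X$; conversely such a set determines a DHO. $\mathbb{D}$ is bilinear if $\beta$ is $\mathbb{F}_2$-linear. The opposite map $\beta^\circ$ is defined by $\mathbf x\beta^\circ(\mathbf y)=\mathbf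 y\beta(\mathbf x)$, and $\mathbb{D}^\circ=\{X^\circ(\mathbf a):\mathbf a\in X\}$ with $X^\circ(\mathbf a)=\{(\mathbf x,\mathbf x\beta^\circ(\mathbf a)):\mathbf x\in X\}$. -}

module Defs where

open import Data.Nat using (ℕ)
open import Data.Bool using (Bool; true; false; _xor_; _∧_)
open import Data.Vec using (Vec; []; _∷_; replicate; zipWith; tabulate; lookup)
open import Data.Fin using (Fin; _≟_)
open import Data.Product using (_×_; _,_; ∃)
open import Relation.Binary.PropositionalEquality using (_≡_; _≢_)
open import Relation.Nullary using (¬_; yes; no)

-- F₂ is Bool with xor as addition and ∧ as multiplication.
-- F₂-vector space of dimension k: row vectors.
V : ℕ → Set
V k = Vec Bool k

𝟎 : ∀ {k} → V k
𝟎 = replicate _ false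

_⊕_ : ∀ {k} → V k → V k → V k
_⊕_ = zipWith _xor_

_·_ : ∀ {k} → Bool → V k → V k
c · v = Data.Vec.map (c ∧_) v

-- Hom(X,Y) for X = F₂ⁿ, Y = F₂ʳ: n × r matrices (n rows of length r),
-- acting on row vectors from the right.
Mat : ℕ → ℕ → Set
Mat n r = Vec (V r) n

_⊕ᴹ_ : ∀ {n r} → Mat n r → Mat n r → Mat n r
_⊕ᴹ_ = zipWith _⊕_

_▸_ : ∀ {n r} → V n → Mat n r → V r
[] ▸ [] = 𝟎
(c ∷ x) ▸ (m ∷ M) = (c · m) ⊕ (x ▸ M)

e : ∀ {n} → Fin n → V n
e i = tabulate (λ j → isEq j)
  where
  isEq : _ → Bool
  isEq j with i ≟ j
  ... | yes _ = true
  ... | no _ = false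

Pt : ℕ → ℕ → Set
Pt n r = V n × V r

𝟎ᵖ : ∀ {n r} → Pt n r
𝟎ᵖ = 𝟎 , 𝟎

_∈X[_]_ : ∀ {n r} → Pt n r → (V n → Mat n r) → V n → Set
(x , y) ∈X[ β ] a = y ≡ x ▸ β a

-- β is F₂-linear (additivity is F₂-linearity)
IsLinear : ∀ {n r} → (V n → Mat n r) → Set
IsLinear β = ∀ a b → β (a ⊕ b) ≡ β a ⊕ᴹ β b

-- Each X(a) is an n-dimensional subspace
-- (graph of a linear map).  Over F₂ a 1-dimensional subspace is {0, p} with
-- p ≠ 0, so "meet in a 1-dim subspace" = exactly one nonzero common point.
-- #𝔻 = 2^{n-1}+…+2+2 = 2ⁿ = #X  ⇔  the X(a), a ∈ X, are pairwise distinct.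
record IsDHO (n r : ℕ) (β : V n → Mat n r) : Set where
  field
    distinct : ∀ a b → a ≢ b →
      ¬ (∀ p → (p ∈X[ β ] a → p ∈X[ β ] b) × (p ∈X[ β ] b → p ∈X[ β ] a))
    pair : ∀ a b → a ≢ b →
      ∃ λ p → p ≢ 𝟎ᵖ × p ∈X[ β ] a × p ∈X[ β ] b ×
        (∀ q → q ≢ 𝟎ᵖ → q ∈X[ β ] a → q ∈X[ β ] b → q ≡ p)
    triple : ∀ a b c → a ≢ b → b ≢ c → a ≢ c →
      ∀ p → p ∈X[ β ] a → p ∈X[ β ] b → p ∈X[ β ] c → p ≡ 𝟎ᵖ

-- The opposite map β°: x β°(a) = a β(x).  Row i of β°(a) is eᵢ β°(a) = a β(eᵢ).
opp : ∀ {n r} → (V n → Mat n r) → (V n → Mat n r)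
opp β a = tabulate (λ i → a ▸ β (e i))

-- For linear β the points of X(a) ∩ X(b) are the (x , x β(a)) with x ∈ ker β(a ⊕ b), so the
-- DHO axioms say exactly that every β(c), c ≢ 𝟎, has a one-dimensional kernel {𝟎, k(c)} and
-- that these kernels meet only in 𝟎, i.e. that c ↦ k(c) is injective on nonzero vectors; by
-- finiteness of V n it is then bijective. Since x β°(a) = a β(x), the kernel of β°(a) is
-- {x : a ∈ ker β(x)}: surjectivity of k makes it one-dimensional, and one-dimensionality of
-- the kernels of β makes those of β° meet only in 𝟎.
module Submission where

open import Defs
open import Data.Nat using (ℕ; zero; suc; _≤_; _^_; s≤s)
open import Data.Nat.Properties using (1+n≰n)
open import Data.Bool using (true; false; _xor_)
open import Data.Bool.Properties using (xor-assoc; xor-comm; xor-identityˡ; xor-identityʳ; xor-same)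
import Data.Bool.Properties as Bool
open import Data.Vec using (Vec; []; _∷_; tabulate; lookup)
open import Data.Vec.Properties
  using (zipWith-assoc; zipWith-comm; zipWith-identityˡ; zipWith-identityʳ; map-id; map-const;
         tabulate-cong; lookup∘tabulate; lookup-replicate; lookup-zipWith; ≡-dec)
open import Data.Vec.Relation.Binary.Pointwise.Extensional using (ext; Pointwise-≡⇒≡)
open import Data.Vec.Recursive using (Fin[m^n]↔Fin[m]^n; lift↔)
open import Data.Vec.Recursive.Properties using (↔Vec)
open import Data.Fin using (Fin; zero; suc; punchOut; _≟_)
open import Data.Fin.Properties using (any?; punchOut-injective; injective⇒≤; 2↔Bool)
open import Data.Product using (_×_; _,_; proj₁; proj₂; ∃)
open import Data.Empty using (⊥-elim)
open import Function using (_∘_; _∋_; _↔_; Inverse)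
open import Function.Definitions using (Injective)
open import Function.Properties.Inverse using (↔-sym; ↔-trans; ↔⇒↣)
open import Function.Bundles using (Injection)
open import Relation.Binary.Definitions using (DecidableEquality)
open import Relation.Binary.PropositionalEquality
open import Relation.Nullary using (yes; no; does; ¬_)
open import Relation.Nullary.Decidable using (decidable-stable)

⊕-assoc : ∀ {k} (x y z : V k) → (x ⊕ y) ⊕ z ≡ x ⊕ (y ⊕ z)
⊕-assoc = zipWith-assoc xor-assoc

⊕-comm : ∀ {k} (x y : V k) → x ⊕ y ≡ y ⊕ x
⊕-comm = zipWith-comm xor-comm

⊕-identityˡ : ∀ {k} (x : V k) → 𝟎 ⊕ x ≡ x
⊕-identityˡ = zipWith-identityˡ xor-identityˡ

⊕-identityʳ : ∀ {k} (x : V k) → x ⊕ 𝟎 ≡ x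
⊕-identityʳ = zipWith-identityʳ xor-identityʳ

⊕-self : ∀ {k} (x : V k) → x ⊕ x ≡ 𝟎
⊕-self []      = refl
⊕-self (a ∷ x) = cong₂ _∷_ (xor-same a) (⊕-self x)

x⊕[x⊕y]≡y : ∀ {k} (x y : V k) → x ⊕ (x ⊕ y) ≡ y
x⊕[x⊕y]≡y x y = begin
  x ⊕ (x ⊕ y)  ≡⟨ ⊕-assoc x x y ⟨
  (x ⊕ x) ⊕ y  ≡⟨ cong (_⊕ y) (⊕-self x) ⟩
  𝟎 ⊕ y        ≡⟨ ⊕-identityˡ y ⟩
  y            ∎
  where open ≡-Reasoning

⊕-cancelˡ : ∀ {k} (x : V k) {y z} → x ⊕ y ≡ x ⊕ z → y ≡ z
⊕-cancelˡ x {y} {z} eq = trans (sym (x⊕[x⊕y]≡y x y)) (trans (cong (x ⊕_) eq) (x⊕[x⊕y]≡y x z))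

x⊕y≡𝟎⇒x≡y : ∀ {k} {x y : V k} → x ⊕ y ≡ 𝟎 → x ≡ y
x⊕y≡𝟎⇒x≡y {x = x} eq = sym (⊕-cancelˡ x (trans eq (sym (⊕-self x))))

⊕-interchange : ∀ {k} (a b c d : V k) → (a ⊕ b) ⊕ (c ⊕ d) ≡ (a ⊕ c) ⊕ (b ⊕ d)
⊕-interchange a b c d = begin
  (a ⊕ b) ⊕ (c ⊕ d)  ≡⟨ ⊕-assoc a b (c ⊕ d) ⟩
  a ⊕ (b ⊕ (c ⊕ d))  ≡⟨ cong (a ⊕_) (⊕-assoc b c d) ⟨
  a ⊕ ((b ⊕ c) ⊕ d)  ≡⟨ cong (λ z → a ⊕ (z ⊕ d)) (⊕-comm b c) ⟩
  a ⊕ ((c ⊕ b) ⊕ d)  ≡⟨ cong (a ⊕_) (⊕-assoc c b d) ⟩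
  a ⊕ (c ⊕ (b ⊕ d))  ≡⟨ ⊕-assoc a c (b ⊕ d) ⟨
  (a ⊕ c) ⊕ (b ⊕ d)  ∎
  where open ≡-Reasoning

_≟ᵛ_ : ∀ {k} → DecidableEquality (V k)
_≟ᵛ_ = ≡-dec Bool._≟_

true·v≡v : ∀ {k} (v : V k) → true · v ≡ v
true·v≡v = map-id

false·v≡𝟎 : ∀ {k} (v : V k) → false · v ≡ 𝟎
false·v≡𝟎 v = map-const v false

·-distribˡ-⊕ : ∀ {k} c (u v : V k) → c · (u ⊕ v) ≡ (c · u) ⊕ (c · v)
·-distribˡ-⊕ true  u v = trans (true·v≡v _) (sym (cong₂ _⊕_ (true·v≡v u) (true·v≡v v)))
·-distribˡ-⊕ false u v =
  trans (false·v≡𝟎 _) (sym (trans (cong₂ _⊕_ (false·v≡𝟎 u) (false·v≡𝟎 v)) (⊕-self 𝟎)))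

·-distribʳ-xor : ∀ {k} c d (v : V k) → (c xor d) · v ≡ (c · v) ⊕ (d · v)
·-distribʳ-xor true true v =
  trans (false·v≡𝟎 v) (sym (trans (cong₂ _⊕_ (true·v≡v v) (true·v≡v v)) (⊕-self v)))
·-distribʳ-xor true false v =
  trans (true·v≡v v) (sym (trans (cong₂ _⊕_ (true·v≡v v) (false·v≡𝟎 v)) (⊕-identityʳ v)))
·-distribʳ-xor false d v = sym (trans (cong (_⊕ (d · v)) (false·v≡𝟎 v)) (⊕-identityˡ _))

▸-distribˡ : ∀ {n r} (x : V n) (M N : Mat n r) → x ▸ (M ⊕ᴹ N) ≡ (x ▸ M) ⊕ (x ▸ N)
▸-distribˡ [] [] [] = sym (⊕-self 𝟎)
▸-distribˡ (c ∷ x) (m ∷ M) (n ∷ N) =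
  trans (cong₂ _⊕_ (·-distribˡ-⊕ c m n) (▸-distribˡ x M N)) (⊕-interchange _ _ _ _)

▸-distribʳ : ∀ {n r} (x y : V n) (M : Mat n r) → (x ⊕ y) ▸ M ≡ (x ▸ M) ⊕ (y ▸ M)
▸-distribʳ [] [] [] = sym (⊕-self 𝟎)
▸-distribʳ (a ∷ x) (b ∷ y) (m ∷ M) =
  trans (cong₂ _⊕_ (·-distribʳ-xor a b m) (▸-distribʳ x y M)) (⊕-interchange _ _ _ _)

▸-zeroˡ : ∀ {n r} (M : Mat n r) → 𝟎 ▸ M ≡ 𝟎
▸-zeroˡ [] = refl
▸-zeroˡ (m ∷ M) = trans (cong₂ _⊕_ (false·v≡𝟎 m) (▸-zeroˡ M)) (⊕-self 𝟎)

IsAdditive : ∀ {m r} → (V m → V r) → Set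
IsAdditive f = ∀ u v → f (u ⊕ v) ≡ f u ⊕ f v

additive⇒𝟎↦𝟎 : ∀ {m r} {f : V m → V r} → IsAdditive f → f 𝟎 ≡ 𝟎
additive⇒𝟎↦𝟎 {f = f} add = begin
  f 𝟎              ≡⟨ x⊕[x⊕y]≡y (f 𝟎) (f 𝟎) ⟨
  f 𝟎 ⊕ (f 𝟎 ⊕ f 𝟎) ≡⟨ cong (f 𝟎 ⊕_) (add 𝟎 𝟎) ⟨
  f 𝟎 ⊕ f (𝟎 ⊕ 𝟎)   ≡⟨ cong (λ z → f 𝟎 ⊕ f z) (⊕-self 𝟎) ⟩
  f 𝟎 ⊕ f 𝟎         ≡⟨ ⊕-self (f 𝟎) ⟩
  𝟎                 ∎
  where open ≡-Reasoning

linear⇒▸-additive : ∀ {n r} {β : V n → Mat n r} → IsLinear β → ∀ x → IsAdditive (λ a → x ▸ β a)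
linear⇒▸-additive {β = β} lin x a b = trans (cong (x ▸_) (lin a b)) (▸-distribˡ x (β a) (β b))

linear⇒▸β𝟎≡𝟎 : ∀ {n r} {β : V n → Mat n r} → IsLinear β → ∀ x → x ▸ β 𝟎 ≡ 𝟎
linear⇒▸β𝟎≡𝟎 lin x = additive⇒𝟎↦𝟎 (linear⇒▸-additive lin x)

lookup-ext : ∀ {A : Set} {k} {u v : Vec A k} → (∀ j → lookup u j ≡ lookup v j) → u ≡ v
lookup-ext entries = Pointwise-≡⇒≡ (ext entries)

-- e is defined through a with-helper, so its entries are only reachable via lookup∘tabulate.
lookup-e : ∀ {n} (i j : Fin n) → lookup (e i) j ≡ does (i ≟ j)
lookup-e i j with i ≟ j | (lookup (e i) j ≡ _) ∋ lookup∘tabulate _ j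
... | yes _ | entry = entry
... | no  _ | entry = entry

e-zero : ∀ {n} → e {suc n} zero ≡ true ∷ 𝟎
e-zero {n} = lookup-ext λ
  { zero    → lookup-e {suc n} zero zero
  ; (suc j) → trans (lookup-e {suc n} zero (suc j)) (sym (lookup-replicate j false)) }

e-suc : ∀ {n} (i : Fin n) → e (suc i) ≡ false ∷ e i
e-suc i = lookup-ext λ
  { zero    → lookup-e (suc i) zero
  ; (suc j) → trans (lookup-e (suc i) (suc j)) (sym (lookup-e i j)) }

▸-tabulate-e : ∀ {m r} {f : V m → V r} → IsAdditive f → ∀ x → x ▸ tabulate (f ∘ e) ≡ f x
▸-tabulate-e {zero}  add [] = sym (additive⇒𝟎↦𝟎 add)
▸-tabulate-e {suc m} {f = f} add (c ∷ x) = begin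
  (c · f (e zero)) ⊕ (x ▸ tabulate (f ∘ e ∘ suc))
    ≡⟨ cong₂ _⊕_ (cong (λ v → c · f v) e-zero) (cong (x ▸_) (tabulate-cong (cong f ∘ e-suc))) ⟩
  (c · f (true ∷ 𝟎)) ⊕ (x ▸ tabulate (f ∘ (false ∷_) ∘ e))
    ≡⟨ cong₂ _⊕_ (scale c) (▸-tabulate-e (λ u v → add (false ∷ u) (false ∷ v)) x) ⟩
  f (c ∷ 𝟎) ⊕ f (false ∷ x)
    ≡⟨ add (c ∷ 𝟎) (false ∷ x) ⟨
  f ((c ∷ 𝟎) ⊕ (false ∷ x))
    ≡⟨ cong f (cong₂ _∷_ (xor-identityʳ c) (⊕-identityˡ x)) ⟩
  f (c ∷ x) ∎
  where
  open ≡-Reasoning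
  scale : ∀ c → c · f (true ∷ 𝟎) ≡ f (c ∷ 𝟎)
  scale true  = true·v≡v _
  scale false = trans (false·v≡𝟎 _) (sym (additive⇒𝟎↦𝟎 add))

▸-opp : ∀ {n r} {β : V n → Mat n r} → IsLinear β → ∀ a x → x ▸ opp β a ≡ a ▸ β x
▸-opp lin a = ▸-tabulate-e (linear⇒▸-additive lin a)

opp-linear : ∀ {n r} (β : V n → Mat n r) → IsLinear (opp β)
opp-linear β a b = lookup-ext λ i → begin
  lookup (opp β (a ⊕ b)) i
    ≡⟨ lookup∘tabulate _ i ⟩
  (a ⊕ b) ▸ β (e i)
    ≡⟨ ▸-distribʳ a b (β (e i)) ⟩
  (a ▸ β (e i)) ⊕ (b ▸ β (e i))
    ≡⟨ cong₂ _⊕_ (lookup∘tabulate _ i) (lookup∘tabulate _ i) ⟨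
  lookup (opp β a) i ⊕ lookup (opp β b) i
    ≡⟨ lookup-zipWith _⊕_ i (opp β a) (opp β b) ⟨
  lookup (opp β a ⊕ᴹ opp β b) i ∎
  where open ≡-Reasoning

Fin-injective⇒surjective : ∀ {k} {f : Fin k → Fin k} → Injective _≡_ _≡_ f → ∀ j → ∃ λ i → f i ≡ j
Fin-injective⇒surjective {zero}  _     ()
Fin-injective⇒surjective {suc k} {f} f-inj j with any? (λ i → f i ≟ j)
... | yes hit  = hit
... | no  miss = ⊥-elim (1+n≰n (injective⇒≤ {f = λ i → punchOut (avoids i)}
                   (λ eq → f-inj (punchOut-injective (avoids _) (avoids _) eq))))
  where
  avoids : ∀ i → j ≢ f i
  avoids i eq = miss (i , sym eq)

V↔Fin : ∀ n → V n ↔ Fin (2 ^ n)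
V↔Fin n = ↔-sym (↔-trans (Fin[m^n]↔Fin[m]^n 2 n) (↔-trans (lift↔ n 2↔Bool) (↔Vec n)))

module _ {A : Set} {k} (A↔Fin : A ↔ Fin k) where
  open Inverse A↔Fin using (to; from)

  private
    to-injective : Injective _≡_ _≡_ to
    to-injective = Injection.injective (↔⇒↣ A↔Fin)

    from-injective : Injective _≡_ _≡_ from
    from-injective = Injection.injective (↔⇒↣ (↔-sym A↔Fin))

  finite-injective⇒surjective : ∀ {f : A → A} → Injective _≡_ _≡_ f → ∀ y → ∃ λ x → f x ≡ y
  finite-injective⇒surjective {f} f-inj y =
    let i , hit = Fin-injective⇒surjective {f = to ∘ f ∘ from}
                    (from-injective ∘ f-inj ∘ to-injective) (to y)
    in from i , to-injective hit

  surjective∧functional⇒total : (R : A → A → Set) → (∀ y → ∃ λ x → R x y) →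
    (∀ {x y y′} → R x y → R x y′ → y ≡ y′) → ∀ x → ∃ λ y → R x y
  surjective∧functional⇒total R surjective functional x =
    let y , pre[y]≡x = finite-injective⇒surjective pre-injective x
    in y , subst (λ z → R z y) pre[y]≡x (proj₂ (surjective y))
    where
    pre : A → A
    pre = proj₁ ∘ surjective

    pre-injective : Injective _≡_ _≡_ pre
    pre-injective {y} {y′} pre[y]≡pre[y′] =
      functional (proj₂ (surjective y))
                 (subst (λ z → R z y′) (sym pre[y]≡pre[y′]) (proj₂ (surjective y′)))

_∈ker_ : ∀ {n r} → V n → Mat n r → Set
x ∈ker M = x ▸ M ≡ 𝟎

OneDimensionalKernels : ∀ {n r} → (V n → Mat n r) → Set
OneDimensionalKernels β =
  ∀ {c} → c ≢ 𝟎 → ∃ λ k → k ≢ 𝟎 × k ∈ker β c × (∀ {x} → x ≢ 𝟎 → x ∈ker β c → x ≡ k)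

KernelsMeetTrivially : ∀ {n r} → (V n → Mat n r) → Set
KernelsMeetTrivially β =
  ∀ {c d x} → c ≢ 𝟎 → d ≢ 𝟎 → c ≢ d → x ∈ker β c → x ∈ker β d → x ≡ 𝟎

a≢b⇒a⊕b≢𝟎 : ∀ {k} {a b : V k} → a ≢ b → a ⊕ b ≢ 𝟎
a≢b⇒a⊕b≢𝟎 a≢b = a≢b ∘ x⊕y≡𝟎⇒x≡y

module _ {n r} {β : V n → Mat n r} where

  ∈X-graph : ∀ (p : Pt n r) a {x} → p ∈X[ β ] a → proj₁ p ≡ x → p ≡ (x , x ▸ β a)
  ∈X-graph _ _ refl refl = refl

  ∈X-𝟎ᵖ : ∀ (p : Pt n r) a → p ∈X[ β ] a → proj₁ p ≡ 𝟎 → p ≡ 𝟎ᵖ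
  ∈X-𝟎ᵖ p a p∈ x≡𝟎 = trans (∈X-graph p a p∈ x≡𝟎) (cong (𝟎 ,_) (▸-zeroˡ (β a)))

  module _ (lin : IsLinear β) where

    ∈X⇒∈ker : ∀ (p : Pt n r) a b → p ∈X[ β ] a → p ∈X[ β ] b → proj₁ p ∈ker β (a ⊕ b)
    ∈X⇒∈ker (x , y) a b y≡xa y≡xb =
      trans (linear⇒▸-additive lin x a b) (trans (cong₂ _⊕_ (sym y≡xa) (sym y≡xb)) (⊕-self y))

    ∈ker⇒∈X : ∀ x a b → x ∈ker β (a ⊕ b) → (x , x ▸ β a) ∈X[ β ] b
    ∈ker⇒∈X x a b x∈ker = x⊕y≡𝟎⇒x≡y (trans (sym (linear⇒▸-additive lin x a b)) x∈ker)

    ∈X[𝟎] : ∀ x → (x , 𝟎) ∈X[ β ] 𝟎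
    ∈X[𝟎] x = sym (linear⇒▸β𝟎≡𝟎 lin x)

    dho⇒oneDimensionalKernels : IsDHO n r β → OneDimensionalKernels β
    dho⇒oneDimensionalKernels dho {c} c≢𝟎 with IsDHO.pair dho c 𝟎 c≢𝟎
    ... | (k , y) , p≢𝟎 , p∈c , p∈𝟎 , unique = k , k≢𝟎 , k∈ker , λ {x} x≢𝟎 x∈ker →
      cong proj₁ (unique (x , 𝟎) (x≢𝟎 ∘ cong proj₁) (sym x∈ker) (∈X[𝟎] x))
      where
      k≢𝟎 : k ≢ 𝟎
      k≢𝟎 = p≢𝟎 ∘ ∈X-𝟎ᵖ (k , y) c p∈c
      k∈ker : k ∈ker β c
      k∈ker = subst (λ a → k ∈ker β a) (⊕-identityʳ c) (∈X⇒∈ker (k , y) c 𝟎 p∈c p∈𝟎)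

    dho⇒kernelsMeetTrivially : IsDHO n r β → KernelsMeetTrivially β
    dho⇒kernelsMeetTrivially dho {x = x} c≢𝟎 d≢𝟎 c≢d x∈c x∈d =
      cong proj₁ (IsDHO.triple dho _ _ 𝟎 c≢d d≢𝟎 c≢𝟎 (x , 𝟎) (sym x∈c) (sym x∈d) (∈X[𝟎] x))

    kernels⇒dho : 2 ≤ n → OneDimensionalKernels β → KernelsMeetTrivially β → IsDHO n r β
    kernels⇒dho (s≤s (s≤s _)) oneDim meet = record
      { distinct = distinct ; pair = pair ; triple = triple }
      where
      distinct : ∀ a b → a ≢ b → ¬ (∀ p → (p ∈X[ β ] a → p ∈X[ β ] b) × (p ∈X[ β ] b → p ∈X[ β ] a))
      distinct a b a≢b same with oneDim (a≢b⇒a⊕b≢𝟎 a≢b)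
      ... | k , _ , _ , unique = e₁≢e₂ (trans (≡k e₁ (λ ())) (sym (≡k e₂ (λ ()))))
        where
        ≡k : ∀ x → x ≢ 𝟎 → x ≡ k
        ≡k x x≢𝟎 = unique x≢𝟎 (∈X⇒∈ker (x , x ▸ β a) a b refl (proj₁ (same (x , x ▸ β a)) refl))
        -- 2 ≤ n supplies two distinct nonzero vectors, both in the one-dimensional ker β(a ⊕ b).
        e₁ e₂ : V n
        e₁ = true ∷ 𝟎
        e₂ = false ∷ true ∷ 𝟎
        e₁≢e₂ : e₁ ≢ e₂
        e₁≢e₂ ()

      pair : ∀ a b → a ≢ b → ∃ λ p → p ≢ 𝟎ᵖ × p ∈X[ β ] a × p ∈X[ β ] b ×
                              (∀ q → q ≢ 𝟎ᵖ → q ∈X[ β ] a → q ∈X[ β ] b → q ≡ p)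
      pair a b a≢b with oneDim (a≢b⇒a⊕b≢𝟎 a≢b)
      ... | k , k≢𝟎 , k∈ker , unique =
        (k , k ▸ β a) , k≢𝟎 ∘ cong proj₁ , refl , ∈ker⇒∈X k a b k∈ker ,
        λ q q≢𝟎 q∈a q∈b → ∈X-graph q a q∈a (unique (q≢𝟎 ∘ ∈X-𝟎ᵖ q a q∈a) (∈X⇒∈ker q a b q∈a q∈b))

      triple : ∀ a b c → a ≢ b → b ≢ c → a ≢ c →
               ∀ p → p ∈X[ β ] a → p ∈X[ β ] b → p ∈X[ β ] c → p ≡ 𝟎ᵖ
      triple a b c a≢b b≢c a≢c p p∈a p∈b p∈c = ∈X-𝟎ᵖ p a p∈a
        (meet (a≢b⇒a⊕b≢𝟎 a≢b) (a≢b⇒a⊕b≢𝟎 a≢c) (b≢c ∘ ⊕-cancelˡ a)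
              (∈X⇒∈ker p a b p∈a p∈b) (∈X⇒∈ker p a c p∈a p∈c))

module Opposite {n r} {β : V n → Mat n r} (lin : IsLinear β)
  (oneDim : OneDimensionalKernels β) (meet : KernelsMeetTrivially β) where

  -- 𝟎 is paired with itself only so that the relation lives on the whole finite type V n.
  data Paired : V n → V n → Set where
    zero-zero : Paired 𝟎 𝟎
    kernel    : ∀ {x c} → x ≢ 𝟎 → c ≢ 𝟎 → x ∈ker β c → Paired x c

  paired-surjective : ∀ c → ∃ λ x → Paired x c
  paired-surjective c with c ≟ᵛ 𝟎
  ... | yes refl = 𝟎 , zero-zero
  ... | no  c≢𝟎  with oneDim c≢𝟎
  ...   | k , k≢𝟎 , k∈ker , _ = k , kernel k≢𝟎 c≢𝟎 k∈ker

  paired-functional : ∀ {x c c′} → Paired x c → Paired x c′ → c ≡ c′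
  paired-functional zero-zero           zero-zero             = refl
  paired-functional zero-zero           (kernel 𝟎≢𝟎 _ _)      = ⊥-elim (𝟎≢𝟎 refl)
  paired-functional (kernel 𝟎≢𝟎 _ _)    zero-zero             = ⊥-elim (𝟎≢𝟎 refl)
  paired-functional {c = c} {c′} (kernel x≢𝟎 c≢𝟎 x∈c) (kernel _ c′≢𝟎 x∈c′) =
    decidable-stable (c ≟ᵛ c′) λ c≢c′ → x≢𝟎 (meet c≢𝟎 c′≢𝟎 c≢c′ x∈c x∈c′)

  paired-total : ∀ x → ∃ λ c → Paired x c
  paired-total = surjective∧functional⇒total (V↔Fin n) Paired paired-surjective paired-functional

  ∈ker-opp⇒∈ker : ∀ x a → x ∈ker opp β a → a ∈ker β x
  ∈ker-opp⇒∈ker x a = trans (sym (▸-opp lin a x))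

  ∈ker⇒∈ker-opp : ∀ x a → a ∈ker β x → x ∈ker opp β a
  ∈ker⇒∈ker-opp x a = trans (▸-opp lin a x)

  opp-oneDimensionalKernels : OneDimensionalKernels (opp β)
  opp-oneDimensionalKernels {a} a≢𝟎 with paired-total a
  ... | _ , zero-zero              = ⊥-elim (a≢𝟎 refl)
  ... | x , kernel _ x≢𝟎 a∈ker[x] =
    x , x≢𝟎 , ∈ker⇒∈ker-opp x a a∈ker[x] , λ {x′} x′≢𝟎 x′∈ker →
      decidable-stable (x′ ≟ᵛ x) λ x′≢x →
        a≢𝟎 (meet x′≢𝟎 x≢𝟎 x′≢x (∈ker-opp⇒∈ker x′ a x′∈ker) a∈ker[x])

  opp-kernelsMeetTrivially : KernelsMeetTrivially (opp β)
  opp-kernelsMeetTrivially {c} {d} {x} c≢𝟎 d≢𝟎 c≢d x∈c x∈d =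
    decidable-stable (x ≟ᵛ 𝟎) λ x≢𝟎 →
      let _ , _ , _ , unique = oneDim x≢𝟎 in
      c≢d (trans (unique c≢𝟎 (∈ker-opp⇒∈ker x c x∈c)) (sym (unique d≢𝟎 (∈ker-opp⇒∈ker x d x∈d))))

lemma6p3 : (n r : ℕ) → 2 ≤ n → (β : V n → Mat n r) →
    IsLinear β → IsDHO n r β → IsDHO n r (opp β) × IsLinear (opp β)
lemma6p3 n r 2≤n β lin dho =
  kernels⇒dho (opp-linear β) 2≤n opp-oneDimensionalKernels opp-kernelsMeetTrivially ,
  opp-linear β
  where
  open Opposite lin (dho⇒oneDimensionalKernels lin dho) (dho⇒kernelsMeetTrivially lin dho)
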